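{- Let $\pi:V\to\mathbb{A}^1$ be the conic bundle surface given by $x^2-ty^2=(t^2-2)z^2$ in $\mathbb{P}^2\times\mathbb{A}^1$. There is no arithmetic function $\varpi:\mathbb{N}\to\{0,1\}$ and no finite set of primes $S$ with the following property: for every prime $p\notin S$ and every primitive integer vector $(t_0,t_1)$ with $t_0^2-2t_1^2>0$ and $p\,\|\,(t_0^2-2t_1^2)$, one has $\varpi(t_0^2-2t_1^2)=1$ if and only if the fibre $\pi^{ -1}(t_0:t_1)$ (the conic over $t=t_0/t_1$) has a $\mathbb{Q}_p$-point.
   Context: $p\,\|\,m$ means $p\mid m$ and $p^2\nmid m$. -}

module Defs where

open import Data.Nat as ℕ using (ℕ; _^_)
open import Data.Nat.Divisibility using (_∣_)
open import Data.Integer as ℤ using (ℤ; +_; ∣_∣)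
open import Data.Product using (Σ; _×_; _,_)
open import Relation.Nullary using (¬_)

_∥_ : ℕ → ℕ → Set
p ∥ m = (p ∣ m) × ¬ (p ℕ.* p ∣ m)

_≡_[mod_] : ℤ → ℤ → ℕ → Set
a ≡ b [mod n ] = n ∣ ∣ a ℤ.- b ∣

-- A primitive Z_p-point of the projective plane curve Q(x,y,z) = 0
-- (Q a homogeneous integral form), with Z_p = lim Z/p^k:
-- a coherent sequence of integer triples (xₖ,yₖ,zₖ) with
--   (xₖ₊₁,yₖ₊₁,zₖ₊₁) ≡ (xₖ,yₖ,zₖ) mod p^k,  Q(xₖ,yₖ,zₖ) ≡ 0 mod p^k,
-- and not all coordinates divisible by p.
record ZpPoint (p : ℕ) (Q : ℤ → ℤ → ℤ → ℤ) : Set where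
  field
    X Y Z : ℕ → ℤ
    coh-X : ∀ k → X (ℕ.suc k) ≡ X k [mod p ^ k ]
    coh-Y : ∀ k → Y (ℕ.suc k) ≡ Y k [mod p ^ k ]
    coh-Z : ∀ k → Z (ℕ.suc k) ≡ Z k [mod p ^ k ]
    solves : ∀ k → p ^ k ∣ ∣ Q (X k) (Y k) (Z k) ∣
    prim : ∀ k → ¬ ((p ∣ ∣ X k ∣) × (p ∣ ∣ Y k ∣) × (p ∣ ∣ Z k ∣))

-- A homogeneous conic with integer coefficients has a Q_p-point
-- iff (clearing denominators) it has a primitive Z_p-point.
HasQpPoint : ℕ → (ℤ → ℤ → ℤ → ℤ) → Set
HasQpPoint p Q = ZpPoint p Q

normT : ℤ → ℤ → ℤ
normT t0 t1 = t0 ℤ.* t0 ℤ.- + 2 ℤ.* (t1 ℤ.* t1)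

-- The fibre of x² - t y² = (t² - 2) z² over t = t0/t1, multiplied by t1²:
--   t1² x² - t0 t1 y² - (t0² - 2 t1²) z² = 0
fibreForm : ℤ → ℤ → ℤ → ℤ → ℤ → ℤ
fibreForm t0 t1 x y z =
  t1 ℤ.* t1 ℤ.* (x ℤ.* x) ℤ.- t0 ℤ.* t1 ℤ.* (y ℤ.* y) ℤ.- normT t0 t1 ℤ.* (z ℤ.* z)

module Submission where

-- For b ∈ ℕ the fibres over t = b² and t = -b² have the same norm N = b⁴ - 2,
-- so ϖ must give them the same verdict.  The fibre over b² always contains
-- (b : 1 : 0).  The fibre over -b² is x² + b²y² = N z²; for a prime p ≡ 3 (mod 4)
-- with p ∥ N it has no primitive solution mod p², since -1 is not a square
-- mod p (Fermat's little theorem).  Given S, such p ∉ S and b exist: for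
-- a = 1 + 2(ΣS)!, a ≡ 1 modulo every element of S, so a⁴ - 2 ≡ -1 there; yet
-- a⁴ - 2 ≡ 3 (mod 4) has a prime factor p ≡ 3 (mod 4); Hensel's lemma then
-- makes p divide a⁴ - 2 or (a + p)⁴ - 2 exactly once.

open import Data.Nat as ℕ using (ℕ; zero; suc; _!; _∸_; _≤_; _%_; s≤s; z≤n)
import Data.Nat.Properties as ℕP
import Data.Nat.Divisibility as ℕD
open import Data.Nat.Combinatorics using (_C_; nCk≡n!/k![n-k]!; k![n∸k]!∣n!; nCn≡1)
open import Data.Nat.DivMod using (_/_; m*n/n≡m; %-distribˡ-*; m%n<n; m≡m%n+[m/n]*n; [m+kn]%n≡m%n)
open import Data.Nat.Primality using (Prime; euclidsLemma; prime⇒nonTrivial; prime⇒nonZero)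
open import Data.Nat.Primality.Factorisation using (factorise; PrimeFactorisation)
open import Data.Nat.Coprimality using (Coprime; 1-coprimeTo)
import Data.Nat.Coprimality as Coprimality
open import Data.Nat.ListAction using (sum; product)
open import Data.Nat.Tactic.RingSolver as ℕSolver using ()
open import Data.Integer as ℤ using (ℤ; +_; -[1+_]; _+_; _*_; _-_; -_; 0ℤ; 1ℤ; _<_)
import Data.Integer.Properties as ℤP
open import Data.Integer.Divisibility.Signed as ℤD using (_∣_; _∣?_; divides)
open import Data.Integer.Tactic.RingSolver using (solve-∀)
open import Data.Fin using (Fin; zero; suc; toℕ; fromℕ; inject₁)
import Data.Fin.Properties as FinP
open import Data.Vec.Functional using (tail)
open import Data.Bool using (Bool; true)
open import Data.List using (List; []; _∷_)
open import Data.List.Relation.Unary.All using (All; []; _∷_)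
open import Data.List.Relation.Unary.Any using (here; there)
open import Data.List.Membership.Propositional using (_∈_; _∉_)
open import Data.Product using (Σ; ∃; _×_; _,_; proj₁; proj₂)
open import Data.Sum using (_⊎_; inj₁; inj₂; [_,_]′)
open import Function.Bundles using (_⇔_; Equivalence)
open import Relation.Binary.Bundles using (Setoid)
open import Relation.Binary.Structures using (IsEquivalence)
open import Relation.Binary.PropositionalEquality
open import Relation.Nullary using (¬_; yes; no; contradiction)
open import Algebra.Definitions.RawMonoid ℤ.+-0-rawMonoid using () renaming (sum to ∑)
import Algebra.Definitions.RawSemiring ℤ.+-*-rawSemiring as ℤSemiring
import Algebra.Properties.CommutativeSemiring.Binomial ℤP.+-*-commutativeSemiring as Binomial
open import Defs

prime>1 : ∀ {p} → Prime p → 1 ℕ.< p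
prime>1 {p} p-prime = ℕ.nonTrivial⇒n>1 p {{prime⇒nonTrivial p-prime}}

prime∤1 : ∀ {p} → Prime p → p ℕD.∤ 1
prime∤1 p-prime = ℕD.>⇒∤ (prime>1 p-prime)

prime∤factorial : ∀ {p} → Prime p → ∀ j → j ℕ.< p → p ℕD.∤ j !
prime∤factorial p-prime zero    _   = prime∤1 p-prime
prime∤factorial p-prime (suc j) j<p p∣j! with euclidsLemma (suc j) (j !) p-prime p∣j!
... | inj₁ p∣1+j = ℕP.<⇒≱ j<p (ℕD.∣⇒≤ p∣1+j)
... | inj₂ p∣j!′ = prime∤factorial p-prime j (ℕP.<-trans (ℕP.n<1+n j) j<p) p∣j!′

factorial≡binomial*denominator : ∀ {n k} → k ≤ n → n ! ≡ (n C k) ℕ.* (k ! ℕ.* (n ∸ k) !)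
factorial≡binomial*denominator {n} {k} k≤n with k![n∸k]!∣n! {n} {k} k≤n
... | ℕD.divides q n!≡q*d = begin
    n !          ≡⟨ n!≡q*d ⟩
    q ℕ.* d      ≡⟨ cong (ℕ._* d) q≡nCk ⟩
    (n C k) ℕ.* d ∎
  where
  open ≡-Reasoning
  d = k ! ℕ.* (n ∸ k) !
  instance d≢0 : ℕ.NonZero d
  d≢0 = ℕP._!*_!≢0 k (n ∸ k)
  q≡nCk : q ≡ n C k
  q≡nCk = sym (trans (nCk≡n!/k![n-k]! k≤n) (trans (cong (ℕ._/ d) n!≡q*d) (m*n/n≡m q d)))

∣factorial : ∀ {x n} → 0 ℕ.< x → x ≤ n → x ℕD.∣ n !
∣factorial {suc x} _ x≤n = ℕD.∣-trans (ℕD.m∣m*n (x !)) (ℕD.m≤n⇒m!∣n! x≤n)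

-- The prime p divides every inner binomial coefficient p C k (0 < k < p):
-- it divides p! = (p C k) k! (p-k)! but neither k! nor (p-k)!.
prime∣binomial : ∀ {p k} → Prime p → 0 ℕ.< k → k ℕ.< p → p ℕD.∣ p C k
prime∣binomial {p} {k} p-prime 0<k k<p
  with euclidsLemma (p C k) (k ! ℕ.* (p ∸ k) !) p-prime
         (subst (p ℕD.∣_) (factorial≡binomial*denominator (ℕP.<⇒≤ k<p))
                (∣factorial (ℕP.<⇒≤ (prime>1 p-prime)) ℕP.≤-refl))
... | inj₁ p∣C = p∣C
... | inj₂ p∣d with euclidsLemma (k !) ((p ∸ k) !) p-prime p∣d
...   | inj₁ p∣k! = contradiction p∣k! (prime∤factorial p-prime k k<p)
...   | inj₂ p∣[p-k]! = contradiction p∣[p-k]! (prime∤factorial p-prime (p ∸ k) (ℕP.∸-monoʳ-< {p} {k} {0} 0<k (ℕP.<⇒≤ k<p)))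

∈⇒≤sum : ∀ {x} xs → x ∈ xs → x ≤ sum xs
∈⇒≤sum (y ∷ ys) (here refl) = ℕP.m≤m+n y (sum ys)
∈⇒≤sum (y ∷ ys) (there x∈ys) = ℕP.≤-trans (∈⇒≤sum ys x∈ys) (ℕP.m≤n+m (sum ys) y)

residue-product≡3 : ∀ r s → r ℕ.< 4 → s ℕ.< 4 → (r ℕ.* s) % 4 ≡ 3 → r ≡ 3 ⊎ s ≡ 3
residue-product≡3 3 s _ _ _ = inj₁ refl
residue-product≡3 r 3 _ _ _ = inj₂ refl
residue-product≡3 0 s _ _ ()
residue-product≡3 1 0 _ _ ()
residue-product≡3 1 1 _ _ ()
residue-product≡3 1 2 _ _ ()
residue-product≡3 2 0 _ _ ()
residue-product≡3 2 1 _ _ ()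
residue-product≡3 2 2 _ _ ()
residue-product≡3 (suc (suc (suc (suc _)))) _ (s≤s (s≤s (s≤s (s≤s ())))) _ _
residue-product≡3 _ (suc (suc (suc (suc _)))) _ (s≤s (s≤s (s≤s (s≤s ())))) _

product≡3⇒factor≡3 : ∀ ps → All Prime ps → product ps % 4 ≡ 3 →
                     ∃ λ p → Prime p × p % 4 ≡ 3 × p ℕD.∣ product ps
product≡3⇒factor≡3 []       []          ()
product≡3⇒factor≡3 (x ∷ xs) (px ∷ pxs) prod≡3
  with residue-product≡3 (x % 4) (product xs % 4) (m%n<n x 4) (m%n<n (product xs) 4)
         (trans (sym (%-distribˡ-* x (product xs) 4)) prod≡3)
... | inj₁ x≡3 = x , px , x≡3 , ℕD.m∣m*n (product xs)
... | inj₂ xs≡3 with product≡3⇒factor≡3 xs pxs xs≡3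
...   | p , pp , p≡3 , p∣xs = p , pp , p≡3 , ℕD.∣n⇒∣m*n x p∣xs

primeFactor≡3mod4 : ∀ n → n % 4 ≡ 3 → ∃ λ p → Prime p × p % 4 ≡ 3 × p ℕD.∣ n
primeFactor≡3mod4 (suc n) n≡3 =
  subst (λ k → ∃ λ p → Prime p × p % 4 ≡ 3 × p ℕD.∣ k) (sym isFactorisation)
    (product≡3⇒factor≡3 factors factorsPrime (subst (λ k → k % 4 ≡ 3) isFactorisation n≡3))
  where open PrimeFactorisation (factorise (suc n))

primeFactor4m+3 : ∀ n → n % 4 ≡ 3 → ∃ λ m → Prime (3 ℕ.+ m ℕ.* 4) × (3 ℕ.+ m ℕ.* 4) ℕD.∣ n
primeFactor4m+3 n n≡3 with primeFactor≡3mod4 n n≡3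
... | p , p-prime , p≡3 , p∣n = p / 4 , subst Prime p≡4m+3 p-prime , subst (ℕD._∣ n) p≡4m+3 p∣n
  where
  p≡4m+3 : p ≡ 3 ℕ.+ (p / 4) ℕ.* 4
  p≡4m+3 = trans (m≡m%n+[m/n]*n p 4) (cong (ℕ._+ (p / 4) ℕ.* 4) p≡3)

module Congruence (P : ℤ) where

  infix 4 _≈_
  record _≈_ (a b : ℤ) : Set where
    constructor mk
    field divides-difference : P ∣ a - b
  open _≈_ public

  private
    difference-sym : ∀ a b → b - a ≡ - (a - b)
    difference-sym = solve-∀
    difference-trans : ∀ a b c → a - c ≡ (a - b) + (b - c)
    difference-trans = solve-∀
    difference-+ : ∀ a b c d → (a + c) - (b + d) ≡ (a - b) + (c - d)
    difference-+ = solve-∀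
    difference-* : ∀ a b c d → (a * c) - (b * d) ≡ (a - b) * c + b * (c - d)
    difference-* = solve-∀
    difference-neg : ∀ a b → (- a) - (- b) ≡ - (a - b)
    difference-neg = solve-∀

  ≈-isEquivalence : IsEquivalence _≈_
  ≈-isEquivalence = record
    { refl  = λ {a} → mk (subst (P ∣_) (sym (ℤP.+-inverseʳ a)) (divides 0ℤ refl))
    ; sym   = λ {a} {b} (mk d) → mk (subst (P ∣_) (sym (difference-sym a b)) (ℤD.∣m⇒∣-m d))
    ; trans = λ {a} {b} {c} (mk d) (mk e) → mk (subst (P ∣_) (sym (difference-trans a b c)) (ℤD.∣m∣n⇒∣m+n d e))
    }

  ≈-setoid : Setoid _ _
  ≈-setoid = record { isEquivalence = ≈-isEquivalence }

  open IsEquivalence ≈-isEquivalence public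
    using () renaming (refl to ≈-refl; reflexive to ≈-reflexive)

  +-cong : ∀ {a b c d} → a ≈ b → c ≈ d → a + c ≈ b + d
  +-cong {a} {b} {c} {d} (mk d₁) (mk d₂) =
    mk (subst (P ∣_) (sym (difference-+ a b c d)) (ℤD.∣m∣n⇒∣m+n d₁ d₂))

  *-cong : ∀ {a b c d} → a ≈ b → c ≈ d → a * c ≈ b * d
  *-cong {a} {b} {c} {d} (mk d₁) (mk d₂) =
    mk (subst (P ∣_) (sym (difference-* a b c d)) (ℤD.∣m∣n⇒∣m+n (ℤD.∣m⇒∣m*n c d₁) (ℤD.∣n⇒∣m*n b d₂)))

  neg-cong : ∀ {a b} → a ≈ b → - a ≈ - b
  neg-cong {a} {b} (mk d) = mk (subst (P ∣_) (sym (difference-neg a b)) (ℤD.∣m⇒∣-m d))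

  ^-cong : ∀ {a b} n → a ≈ b → a ℤ.^ n ≈ b ℤ.^ n
  ^-cong zero    _   = ≈-refl
  ^-cong (suc n) a≈b = *-cong a≈b (^-cong n a≈b)

  +≈0⇒≈- : ∀ {a b} → a + b ≈ 0ℤ → a ≈ - b
  +≈0⇒≈- {a} {b} (mk d) = mk (subst (P ∣_) (rearrange a b) d)
    where
    rearrange : ∀ a b → (a + b) - 0ℤ ≡ a - - b
    rearrange = solve-∀

  ∣⇒≈0 : ∀ {a} → P ∣ a → a ≈ 0ℤ
  ∣⇒≈0 {a} d = mk (subst (P ∣_) (sym (ℤP.+-identityʳ a)) d)

prime∣*⇒∣⊎∣ : ∀ {p} → Prime p → ∀ a b → + p ∣ a * b → (+ p ∣ a) ⊎ (+ p ∣ b)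
prime∣*⇒∣⊎∣ {p} p-prime a b p∣ab
  with euclidsLemma ℤ.∣ a ∣ ℤ.∣ b ∣ p-prime (subst (p ℕD.∣_) (ℤP.abs-* a b) (ℤD.∣⇒∣ᵤ p∣ab))
... | inj₁ p∣a = inj₁ (ℤD.∣ᵤ⇒∣ p∣a)
... | inj₂ p∣b = inj₂ (ℤD.∣ᵤ⇒∣ p∣b)

-- The library's binomial theorem is phrased with the generic semiring
-- operations; on ℤ they agree with the concrete ones.
×≡* : ∀ n z → n ℤSemiring.× z ≡ + n * z
×≡* zero    z = sym (ℤP.*-zeroˡ z)
×≡* (suc n) z = begin
  z + n ℤSemiring.× z  ≡⟨ cong (λ w → z + w) (×≡* n z) ⟩
  z + + n * z          ≡⟨ cong (_+ + n * z) (sym (ℤP.*-identityˡ z)) ⟩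
  1ℤ * z + + n * z     ≡⟨ sym (ℤP.*-distribʳ-+ z 1ℤ (+ n)) ⟩
  + suc n * z          ∎
  where open ≡-Reasoning

^≡^ : ∀ z n → z ℤSemiring.^ n ≡ z ℤ.^ n
^≡^ z zero    = refl
^≡^ z (suc n) = cong (z *_) (^≡^ z n)

binomialTerm≡ : ∀ x n k → Binomial.binomialTerm x 1ℤ n k ≡ + (n C toℕ k) * x ℤ.^ toℕ k
binomialTerm≡ x n k = begin
  (n C toℕ k) ℤSemiring.× (x ℤSemiring.^ toℕ k * 1ℤ ℤSemiring.^ (n ℕ.∸ toℕ k))
    ≡⟨ ×≡* (n C toℕ k) _ ⟩
  + (n C toℕ k) * (x ℤSemiring.^ toℕ k * 1ℤ ℤSemiring.^ (n ℕ.∸ toℕ k))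
    ≡⟨ cong (λ w → + (n C toℕ k) * (x ℤSemiring.^ toℕ k * w)) (trans (^≡^ 1ℤ (n ℕ.∸ toℕ k)) (ℤP.^-zeroˡ (n ℕ.∸ toℕ k))) ⟩
  + (n C toℕ k) * (x ℤSemiring.^ toℕ k * 1ℤ)
    ≡⟨ cong (λ w → + (n C toℕ k) * w) (trans (ℤP.*-identityʳ (x ℤSemiring.^ toℕ k)) (^≡^ x (toℕ k))) ⟩
  + (n C toℕ k) * x ℤ.^ toℕ k ∎
  where open ≡-Reasoning

module Fermat (q : ℕ) (prime : Prime (suc q)) where

  private
    p = suc q
  open Congruence (+ p)

  sum≈last : ∀ r (g : Fin (suc r) → ℤ) → (∀ i → g (inject₁ i) ≈ 0ℤ) → ∑ g ≈ g (fromℕ r)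
  sum≈last zero    g _     = ≈-reflexive (ℤP.+-identityʳ (g zero))
  sum≈last (suc r) g init≈0 = begin
    g zero + ∑ (tail g)    ≈⟨ +-cong (init≈0 zero) (sum≈last r (tail g) (λ i → init≈0 (suc i))) ⟩
    0ℤ + g (fromℕ (suc r))   ≡⟨ ℤP.+-identityˡ _ ⟩
    g (fromℕ (suc r))        ∎
    where open import Relation.Binary.Reasoning.Setoid ≈-setoid

  -- "Freshman's dream": all inner binomial coefficients of (x + 1)ᵖ vanish mod p.
  freshman : ∀ x → (x + 1ℤ) ℤ.^ p ≈ x ℤ.^ p + 1ℤ
  freshman x = begin
    (x + 1ℤ) ℤ.^ p                 ≡⟨ sym (^≡^ (x + 1ℤ) p) ⟩
    (x + 1ℤ) ℤSemiring.^ p         ≡⟨ Binomial.theorem p x 1ℤ ⟩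
    term zero + ∑ (tail term)    ≈⟨ +-cong (≈-reflexive first≡1) (sum≈last q (tail term) inner≈0) ⟩
    1ℤ + term (fromℕ p)            ≡⟨ cong (λ w → 1ℤ + w) last≡x^p ⟩
    1ℤ + x ℤ.^ p                   ≡⟨ ℤP.+-comm 1ℤ (x ℤ.^ p) ⟩
    x ℤ.^ p + 1ℤ                   ∎
    where
    open import Relation.Binary.Reasoning.Setoid ≈-setoid
    term = Binomial.binomialTerm x 1ℤ p
    first≡1 : term zero ≡ 1ℤ
    first≡1 = trans (binomialTerm≡ x p zero) (ℤP.*-identityˡ 1ℤ)
    last≡x^p : term (fromℕ p) ≡ x ℤ.^ p
    last≡x^p = trans (binomialTerm≡ x p (fromℕ p))
                 (subst (λ k → + (p C k) * x ℤ.^ k ≡ x ℤ.^ p) (sym (FinP.toℕ-fromℕ p))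
                   (trans (cong (λ c → + c * x ℤ.^ p) (nCn≡1 p)) (ℤP.*-identityˡ (x ℤ.^ p))))
    inner≈0 : (i : Fin q) → term (suc (inject₁ i)) ≈ 0ℤ
    inner≈0 i = ∣⇒≈0 (subst (+ p ∣_) (sym (binomialTerm≡ x p (suc (inject₁ i))))
                  (ℤD.∣m⇒∣m*n (x ℤ.^ suc k) (ℤD.∣ᵤ⇒∣ {+ p} {+ (p C suc k)} (prime∣binomial prime (ℕ.s≤s ℕ.z≤n) (ℕ.s≤s k<q)))))
      where
      k = toℕ (inject₁ i)
      k<q : k ℕ.< q
      k<q = subst (ℕ._< q) (sym (FinP.toℕ-inject₁ i)) (FinP.toℕ<n i)

  fermat : ∀ n → (+ n) ℤ.^ p ≈ + n
  fermat zero    = ≈-refl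
  fermat (suc n) = begin
    (+ suc n) ℤ.^ p       ≡⟨ cong (ℤ._^ p) 1+n≡n+1 ⟩
    (+ n + 1ℤ) ℤ.^ p      ≈⟨ freshman (+ n) ⟩
    (+ n) ℤ.^ p + 1ℤ      ≈⟨ +-cong (fermat n) ≈-refl ⟩
    + n + 1ℤ              ≡⟨ sym 1+n≡n+1 ⟩
    + suc n               ∎
    where
    open import Relation.Binary.Reasoning.Setoid ≈-setoid
    1+n≡n+1 : + suc n ≡ + n + 1ℤ
    1+n≡n+1 = trans (cong +_ (ℕP.+-comm 1 n)) (ℤP.pos-+ n 1)

  -- nᵖ⁻¹ ≡ 1 (mod p) when p ∤ n, cancelling n from nᵖ - n = n (nᵖ⁻¹ - 1).
  fermat′ : ∀ n → ¬ (+ p ∣ + n) → (+ n) ℤ.^ q ≈ 1ℤ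
  fermat′ n p∤n with prime∣*⇒∣⊎∣ prime (+ n) ((+ n) ℤ.^ q - 1ℤ)
                       (subst (+ p ∣_) (factor (+ n) ((+ n) ℤ.^ q)) (divides-difference (fermat n)))
    where
    factor : ∀ a b → a * b - a ≡ a * (b - 1ℤ)
    factor = solve-∀
  ... | inj₁ p∣n = contradiction p∣n p∤n
  ... | inj₂ p∣nᵠ-1 = mk p∣nᵠ-1

abs-square : ∀ x → + ℤ.∣ x ∣ * + ℤ.∣ x ∣ ≡ x * x
abs-square (+ n)    = refl
abs-square -[1+ n ] = refl

square-^ : ∀ a k → (a * a) ℤ.^ k ≡ a ℤ.^ (2 ℕ.* k)
square-^ a k = trans (cong (λ s → (a * s) ℤ.^ k) (sym (ℤP.*-identityʳ a))) (ℤP.^-*-assoc a 2 k)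

neg-^-odd : ∀ d k → (- d) ℤ.^ suc (2 ℕ.* k) ≡ - (d ℤ.^ suc (2 ℕ.* k))
neg-^-odd d k = begin
  (- d) * (- d) ℤ.^ (2 ℕ.* k)   ≡⟨ cong ((- d) *_) (sym (square-^ (- d) k)) ⟩
  (- d) * ((- d) * (- d)) ℤ.^ k ≡⟨ cong (λ s → (- d) * s ℤ.^ k) (neg*neg d) ⟩
  (- d) * (d * d) ℤ.^ k         ≡⟨ sym (ℤP.neg-distribˡ-* d _) ⟩
  - (d * (d * d) ℤ.^ k)         ≡⟨ cong (λ s → - (d * s)) (square-^ d k) ⟩
  - (d * d ℤ.^ (2 ℕ.* k))       ∎
  where
  open ≡-Reasoning
  neg*neg : ∀ d → (- d) * (- d) ≡ d * d
  neg*neg = solve-∀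

prime∣square⇒∣ : ∀ {p} → Prime p → ∀ x → + p ∣ x * x → + p ∣ x
prime∣square⇒∣ p-prime x p∣x² with prime∣*⇒∣⊎∣ p-prime x x p∣x²
... | inj₁ p∣x = p∣x
... | inj₂ p∣x = p∣x

module PrimeThreeModFour (m : ℕ) (prime : Prime (3 ℕ.+ m ℕ.* 4)) where

  p : ℕ
  p = 3 ℕ.+ m ℕ.* 4

  P : ℤ
  P = + p

  open Congruence P
  open Fermat (2 ℕ.+ m ℕ.* 4) prime

  p∤2 : ¬ (P ∣ + 2)
  p∤2 P∣2 = ℕD.>⇒∤ (s≤s (s≤s (s≤s z≤n))) (ℤD.∣⇒∣ᵤ P∣2)

  p-1≡2*odd : 2 ℕ.+ m ℕ.* 4 ≡ 2 ℕ.* suc (2 ℕ.* m)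
  p-1≡2*odd = identity m
    where
    identity : ∀ m → 2 ℕ.+ m ℕ.* 4 ≡ 2 ℕ.* suc (2 ℕ.* m)
    identity = ℕSolver.solve-∀

  -- -1 is not a square mod p: if u² ≡ -w² with p ∤ u w, then raising to the
  -- odd power k gives 1 ≡ uᵖ⁻¹ ≡ -wᵖ⁻¹ ≡ -1 by Fermat, i.e. p ∣ 2.
  sum-of-unit-squares≉0 : ∀ u w → ¬ (P ∣ + u) → ¬ (P ∣ + w) → ¬ (+ u * + u + + w * + w ≈ 0ℤ)
  sum-of-unit-squares≉0 u w p∤u p∤w u²+w²≈0 = p∤2 (divides-difference 1≈-1)
    where
    open import Relation.Binary.Reasoning.Setoid ≈-setoid
    k = suc (2 ℕ.* m)
    U = + u
    W = + w
    1≈-1 : 1ℤ ≈ - 1ℤ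
    1≈-1 = begin
      1ℤ                   ≈⟨ fermat′ u p∤u ⟨
      U ℤ.^ (2 ℕ.+ m ℕ.* 4) ≡⟨ cong (U ℤ.^_) p-1≡2*odd ⟩
      U ℤ.^ (2 ℕ.* k)      ≡⟨ square-^ U k ⟨
      (U * U) ℤ.^ k        ≈⟨ ^-cong k (+≈0⇒≈- {U * U} {W * W} u²+w²≈0) ⟩
      (- (W * W)) ℤ.^ k    ≡⟨ neg-^-odd (W * W) m ⟩
      - ((W * W) ℤ.^ k)    ≡⟨ cong -_ (square-^ W k) ⟩
      - (W ℤ.^ (2 ℕ.* k))  ≡⟨ cong (λ e → - (W ℤ.^ e)) p-1≡2*odd ⟨
      - (W ℤ.^ (2 ℕ.+ m ℕ.* 4)) ≈⟨ neg-cong (fermat′ w p∤w) ⟩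
      - 1ℤ                 ∎

  sum-of-squares⇒∣ : ∀ x y → P ∣ x * x + y * y → P ∣ x
  sum-of-squares⇒∣ x y p∣x²+y² with P ∣? x | P ∣? y
  ... | yes p∣x | _       = p∣x
  ... | no p∤x  | yes p∣y =
    contradiction (prime∣square⇒∣ prime x (ℤD.∣m+n∣n⇒∣m p∣x²+y² (ℤD.∣m⇒∣m*n y p∣y))) p∤x
  ... | no p∤x  | no p∤y  = contradiction
    (∣⇒≈0 (subst (P ∣_) (cong₂ _+_ (sym (abs-square x)) (sym (abs-square y))) p∣x²+y²))
    (sum-of-unit-squares≉0 ℤ.∣ x ∣ ℤ.∣ y ∣ (λ d → p∤x (unabs d)) (λ d → p∤y (unabs d)))
    where
    unabs : ∀ {z} → P ∣ + ℤ.∣ z ∣ → P ∣ z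
    unabs d = ℤD.∣ᵤ⇒∣ (ℤD.∣⇒∣ᵤ d)

  -- The conic x² + c²y² = N z², with p ∤ c and p ∥ N, has no solution mod p²
  -- other than the trivial one mod p: first p ∣ x, cy (sum of squares), so
  -- p² ∣ N z², and p ∥ N forces p ∣ z.
  conic-obstruction : ∀ c N x y z → ¬ (P ∣ c) → P ∣ N → ¬ (P * P ∣ N) →
                      P * P ∣ (x * x + (c * c) * (y * y)) - N * (z * z) →
                      P ∣ x × P ∣ y × P ∣ z
  conic-obstruction c N x y z p∤c p∣N p²∤N p²∣Q = p∣x , p∣y , p∣z
    where
    rearrange : ∀ x y c n z → (x * x + (c * c) * (y * y)) - n * (z * z) + n * (z * z)
                              ≡ x * x + (c * y) * (c * y)
    rearrange = solve-∀
    p∣x²+[cy]² : P ∣ x * x + (c * y) * (c * y)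
    p∣x²+[cy]² = subst (P ∣_) (rearrange x y c N z)
                   (ℤD.∣m∣n⇒∣m+n (ℤD.∣-trans (ℤD.∣m⇒∣m*n P ℤD.∣-refl) p²∣Q) (ℤD.∣m⇒∣m*n (z * z) p∣N))
    p∣x : P ∣ x
    p∣x = sum-of-squares⇒∣ x (c * y) p∣x²+[cy]²
    p∣y : P ∣ y
    p∣y = [ (λ p∣c → contradiction p∣c p∤c) , (λ p∣y → p∣y) ]′
            (prime∣*⇒∣⊎∣ prime c y
               (sum-of-squares⇒∣ (c * y) x (subst (P ∣_) (ℤP.+-comm (x * x) ((c * y) * (c * y))) p∣x²+[cy]²)))
    square∣ : ∀ {a} → P ∣ a → P * P ∣ a * a
    square∣ {a} d = ℤD.∣-trans (ℤD.*-monoˡ-∣ P d) (ℤD.*-monoʳ-∣ a d)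
    p²∣Nz² : P * P ∣ N * (z * z)
    p²∣Nz² = subst (P * P ∣_) (difference (x * x + (c * c) * (y * y)) (N * (z * z)))
               (ℤD.∣m∣n⇒∣m-n (ℤD.∣m∣n⇒∣m+n (square∣ p∣x) (ℤD.∣n⇒∣m*n (c * c) (square∣ p∣y))) p²∣Q)
      where
      difference : ∀ a b → a - (a - b) ≡ b
      difference = solve-∀
    s = ℤD.quotient p∣N
    p∣sz² : P ∣ s * (z * z)
    p∣sz² = ℤD.*-cancelˡ-∣ P (subst (P * P ∣_) N·z²≡P·sz² p²∣Nz²)
      where
      reassociate : ∀ s P a → (s * P) * a ≡ P * (s * a)
      reassociate = solve-∀
      N·z²≡P·sz² : N * (z * z) ≡ P * (s * (z * z))
      N·z²≡P·sz² = trans (cong (_* (z * z)) (ℤD._∣_.equality p∣N)) (reassociate s P (z * z))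
    p∣z : P ∣ z
    p∣z = [ (λ p∣s → contradiction (subst (P * P ∣_) (sym (ℤD._∣_.equality p∣N)) (ℤD.*-monoˡ-∣ P p∣s)) p²∤N)
          , prime∣square⇒∣ prime z ]′
          (prime∣*⇒∣⊎∣ prime s (z * z) p∣sz²)

-- The fibres used in the proof lie over t = ±a² (t₁ = 1); both have the
-- same norm a⁴ - 2.
square : ℕ → ℤ
square a = + a * + a

norm : ℕ → ℤ
norm a = normT (square a) (+ 1)

normT-neg : ∀ t → normT (- t) (+ 1) ≡ normT t (+ 1)
normT-neg = identity
  where
  identity : ∀ t → (- t) * (- t) - + 2 * (+ 1 * + 1) ≡ t * t - + 2 * (+ 1 * + 1)
  identity = solve-∀

norm-value : ∀ a n → n ℕ.+ 2 ≡ a ℕ.* a ℕ.* (a ℕ.* a) → norm a ≡ + n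
norm-value a n n+2≡a⁴ = begin
  square a * square a - + 2    ≡⟨ cong (_- + 2) (cong₂ _*_ (ℤP.pos-* a a) (ℤP.pos-* a a)) ⟨
  + (a ℕ.* a) * + (a ℕ.* a) - + 2 ≡⟨ cong (λ s → s - + 2) (ℤP.pos-* (a ℕ.* a) (a ℕ.* a)) ⟨
  + (a ℕ.* a ℕ.* (a ℕ.* a)) - + 2 ≡⟨ cong (λ s → + s - + 2) n+2≡a⁴ ⟨
  + (n ℕ.+ 2) - + 2             ≡⟨ cong (_- + 2) (ℤP.pos-+ n 2) ⟩
  + n + + 2 - + 2               ≡⟨ cancel (+ n) (+ 2) ⟩
  + n                           ∎
  where
  open ≡-Reasoning
  cancel : ∀ x y → x + y - y ≡ x
  cancel = solve-∀

norm-positive : ∀ {a} → 2 ≤ a → + 0 < norm a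
norm-positive {a} 2≤a =
  subst (+ 0 <_) (sym (norm-value a (a⁴ ℕ.∸ 2) (ℕP.m∸n+n≡m (ℕP.<⇒≤ 2<a⁴))))
    (ℤ.+<+ (ℕP.m<n⇒0<n∸m 2<a⁴))
  where
  a⁴ = a ℕ.* a ℕ.* (a ℕ.* a)
  2<a⁴ : 2 ℕ.< a⁴
  2<a⁴ = ℕP.<-≤-trans (s≤s (s≤s (s≤s z≤n)))
           (ℕP.*-mono-≤ (ℕP.*-mono-≤ 2≤a 2≤a) (ℕP.*-mono-≤ 2≤a 2≤a))

norm-odd : ∀ K → 1 ≤ K → ∃ λ n → norm (1 ℕ.+ 2 ℕ.* K) ≡ + n × n % 4 ≡ 3
norm-odd (suc k) _ = n , norm-value (1 ℕ.+ 2 ℕ.* suc k) n (expand k) , [m+kn]%n≡m%n 3 (M k) 4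
  where
  M : ℕ → ℕ
  M k = 4 ℕ.* (k ℕ.* k ℕ.* (k ℕ.* k)) ℕ.+ 24 ℕ.* (k ℕ.* k ℕ.* k) ℕ.+ 54 ℕ.* (k ℕ.* k) ℕ.+ 54 ℕ.* k ℕ.+ 19
  n = 3 ℕ.+ M k ℕ.* 4
  expand : ∀ k → (3 ℕ.+ (4 ℕ.* (k ℕ.* k ℕ.* (k ℕ.* k)) ℕ.+ 24 ℕ.* (k ℕ.* k ℕ.* k) ℕ.+ 54 ℕ.* (k ℕ.* k) ℕ.+ 54 ℕ.* k ℕ.+ 19) ℕ.* 4) ℕ.+ 2
                 ≡ (1 ℕ.+ 2 ℕ.* suc k) ℕ.* (1 ℕ.+ 2 ℕ.* suc k) ℕ.* ((1 ℕ.+ 2 ℕ.* suc k) ℕ.* (1 ℕ.+ 2 ℕ.* suc k))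
  expand = ℕSolver.solve-∀

module NormModOddPrime (p : ℕ) (prime : Prime p) (p∤2 : ¬ (+ p ∣ + 2)) where

  private
    P = + p
  open Congruence P

  ∣norm⇒∤ : ∀ a → P ∣ norm a → ¬ (P ∣ + a)
  ∣norm⇒∤ a p∣N p∣a = p∤2 (subst (P ∣_) (a⁴-N≡2 (+ a)) (ℤD.∣m∣n⇒∣m-n p∣a⁴ p∣N))
    where
    a⁴-N≡2 : ∀ A → (A * A) * (A * A) - ((A * A) * (A * A) - + 2 * (+ 1 * + 1)) ≡ + 2
    a⁴-N≡2 = solve-∀
    p∣a⁴ : P ∣ square a * square a
    p∣a⁴ = ℤD.∣m⇒∣m*n (square a) (ℤD.∣m⇒∣m*n (+ a) p∣a)

  ≈1⇒∤norm : ∀ a → + a ≈ 1ℤ → ¬ (P ∣ norm a)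
  ≈1⇒∤norm a a≈1 p∣N = prime∤1 prime (ℤD.∣⇒∣ᵤ (divides-difference 0≈-1))
    where
    open import Relation.Binary.Reasoning.Setoid ≈-setoid
    a²≈1 = *-cong a≈1 a≈1
    0≈-1 : 0ℤ ≈ - 1ℤ
    0≈-1 = begin
      0ℤ     ≈⟨ ∣⇒≈0 p∣N ⟨
      norm a ≈⟨ +-cong (*-cong a²≈1 a²≈1) ≈-refl ⟩
      - 1ℤ   ∎

  -- Hensel's lemma for the simple root a of X⁴ - 2 mod p: moving from a to a + p
  -- changes a⁴ - 2 by 4a³p mod p², which is not divisible by p².
  shift-by-p : ∀ a → P ∣ norm a →
               P ∣ norm (a ℕ.+ p) × (P * P ∣ norm a → ¬ (P * P ∣ norm (a ℕ.+ p)))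
  shift-by-p a p∣N = p∣N′ , p²∤both
    where
    A = + a
    linear = + 4 * (A * (A * A))
    rest = + 6 * (A * A) + + 4 * (A * P) + P * P
    expand : ∀ A P → ((A + P) * (A + P)) * ((A + P) * (A + P)) - + 2 * (+ 1 * + 1)
                       - ((A * A) * (A * A) - + 2 * (+ 1 * + 1))
                     ≡ P * (+ 4 * (A * (A * A))) + (P * P) * (+ 6 * (A * A) + + 4 * (A * P) + P * P)
    expand = solve-∀
    difference : norm (a ℕ.+ p) - norm a ≡ P * linear + (P * P) * rest
    difference = trans (cong (λ s → normT (s * s) (+ 1) - norm a) (ℤP.pos-+ a p)) (expand A P)
    p∣difference : P ∣ norm (a ℕ.+ p) - norm a
    p∣difference = subst (P ∣_) (sym difference)
      (ℤD.∣m∣n⇒∣m+n (ℤD.∣m⇒∣m*n linear ℤD.∣-refl) (ℤD.∣m⇒∣m*n rest (ℤD.∣m⇒∣m*n P ℤD.∣-refl)))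
    add-back : ∀ x y → x - y + y ≡ x
    add-back = solve-∀
    p∣N′ : P ∣ norm (a ℕ.+ p)
    p∣N′ = subst (P ∣_) (add-back _ (norm a)) (ℤD.∣m∣n⇒∣m+n p∣difference p∣N)
    p∤linear : ¬ (P ∣ linear)
    p∤linear p∣4a³ =
      [ (λ p∣4 → p∤2 (prime∣square⇒∣ prime (+ 2) p∣4))
      , (λ p∣a³ → ∣norm⇒∤ a p∣N
          ([ (λ p∣a → p∣a) , prime∣square⇒∣ prime A ]′ (prime∣*⇒∣⊎∣ prime A (A * A) p∣a³))) ]′
      (prime∣*⇒∣⊎∣ prime (+ 4) (A * (A * A)) p∣4a³)
    drop-rest : ∀ x y → x + y - y ≡ x
    drop-rest = solve-∀
    p²∤both : P * P ∣ norm a → ¬ (P * P ∣ norm (a ℕ.+ p))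
    p²∤both p²∣N p²∣N′ = p∤linear (ℤD.*-cancelˡ-∣ P {{prime⇒nonZero prime}}
      (subst (P * P ∣_) (trans (cong (_- (P * P) * rest) difference) (drop-rest (P * linear) _))
        (ℤD.∣m∣n⇒∣m-n (ℤD.∣m∣n⇒∣m-n p²∣N′ p²∣N) (ℤD.∣m⇒∣m*n rest ℤD.∣-refl))))

  exact-divisor : ∀ a → P ∣ norm a → ∃ λ b → a ≤ b × P ∣ norm b × ¬ (P * P ∣ norm b)
  exact-divisor a p∣N with P * P ∣? norm a
  ... | no p²∤N  = a , ℕP.≤-refl , p∣N , p²∤N
  ... | yes p²∣N = a ℕ.+ p , ℕP.m≤m+n a p , proj₁ (shift-by-p a p∣N) , proj₂ (shift-by-p a p∣N) p²∣N

Detector : (ℕ → Bool) → ℕ → Set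
Detector ϖ p = ∀ (t₀ t₁ : ℤ) → Coprime ℤ.∣ t₀ ∣ ℤ.∣ t₁ ∣ → + 0 < normT t₀ t₁ → p ∥ ℤ.∣ normT t₀ t₁ ∣ →
               (ϖ ℤ.∣ normT t₀ t₁ ∣ ≡ true ⇔ HasQpPoint p (fibreForm t₀ t₁))

fibre-over-square-has-point : ∀ {p} → Prime p → ∀ a → HasQpPoint p (fibreForm (square a) (+ 1))
fibre-over-square-has-point {p} p-prime a = record
  { X = λ _ → + a ; Y = λ _ → 1ℤ ; Z = λ _ → 0ℤ
  ; coh-X = λ k → subst (λ v → p ℕ.^ k ℕD.∣ ℤ.∣ v ∣) (sym (ℤP.+-inverseʳ (+ a))) (ℕD._∣0 (p ℕ.^ k))
  ; coh-Y = λ k → ℕD._∣0 (p ℕ.^ k)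
  ; coh-Z = λ k → ℕD._∣0 (p ℕ.^ k)
  ; solves = λ k → subst (λ v → p ℕ.^ k ℕD.∣ ℤ.∣ v ∣) (sym (on-point (+ a) (norm a))) (ℕD._∣0 (p ℕ.^ k))
  ; prim = λ k p∣coordinates → prime∤1 p-prime (proj₁ (proj₂ p∣coordinates))
  }
  where
  on-point : ∀ A N → + 1 * + 1 * (A * A) - (A * A) * + 1 * (+ 1 * + 1) - N * (0ℤ * 0ℤ) ≡ 0ℤ
  on-point = solve-∀

∥⇒∣×∤ : ∀ {p N} → p ∥ ℤ.∣ N ∣ → (+ p ∣ N) × ¬ (+ p * + p ∣ N)
∥⇒∣×∤ {p} {N} (p∣N , p²∤N) =
  ℤD.∣ᵤ⇒∣ p∣N , λ p²∣N → p²∤N (subst (ℕD._∣ ℤ.∣ N ∣) (ℤP.abs-* (+ p) (+ p)) (ℤD.∣⇒∣ᵤ p²∣N))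

∣×∤⇒∥ : ∀ {p N} → + p ∣ N → ¬ (+ p * + p ∣ N) → p ∥ ℤ.∣ N ∣
∣×∤⇒∥ {p} {N} p∣N p²∤N =
  ℤD.∣⇒∣ᵤ p∣N , λ p²∣N → p²∤N (subst (_∣ N) (ℤP.pos-* p p) (ℤD.∣ᵤ⇒∣ p²∣N))

module _ (m : ℕ) (prime : Prime (3 ℕ.+ m ℕ.* 4)) where

  open PrimeThreeModFour m prime
  open NormModOddPrime p prime p∤2

  -- Over t = -b² the fibre x² + b²y² = N z² (N = b⁴ - 2) has no Q_p-point when
  -- p ∥ N: a point mod p² would be divisible by p (conic obstruction).
  fibre-over-minus-square-has-no-point : ∀ b → p ∥ ℤ.∣ norm b ∣ → ¬ HasQpPoint p (fibreForm (- square b) (+ 1))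
  fibre-over-minus-square-has-no-point b p∥N point =
    prim 2 (ℤD.∣⇒∣ᵤ p∣x , ℤD.∣⇒∣ᵤ p∣y , ℤD.∣⇒∣ᵤ p∣z)
    where
    open ZpPoint point
    B = + b
    x = X 2
    y = Y 2
    z = Z 2
    form = fibreForm (- square b) (+ 1) x y z
    conic : ∀ B x y z N → + 1 * + 1 * (x * x) - (- (B * B)) * + 1 * (y * y) - N * (z * z)
                         ≡ (x * x + (B * B) * (y * y)) - N * (z * z)
    conic = solve-∀
    form≡conic : form ≡ (x * x + (B * B) * (y * y)) - norm b * (z * z)
    form≡conic = trans (conic B x y z (normT (- square b) (+ 1)))
                   (cong (λ N → (x * x + (B * B) * (y * y)) - N * (z * z)) (normT-neg (square b)))
    p²∣form : P * P ∣ form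
    p²∣form = subst (_∣ form) (ℤP.pos-* p p)
                (ℤD.∣ᵤ⇒∣ (subst (ℕD._∣ ℤ.∣ form ∣) (cong (p ℕ.*_) (ℕP.*-identityʳ p)) (solves 2)))
    p∣N = proj₁ (∥⇒∣×∤ p∥N)
    p∣xyz = conic-obstruction B (norm b) x y z (∣norm⇒∤ b p∣N) p∣N (proj₂ (∥⇒∣×∤ p∥N))
              (subst (P * P ∣_) form≡conic p²∣form)
    p∣x = proj₁ p∣xyz
    p∣y = proj₁ (proj₂ p∣xyz)
    p∣z = proj₂ (proj₂ p∣xyz)

  no-detector : ∀ ϖ b → 2 ≤ b → p ∥ ℤ.∣ norm b ∣ → ¬ Detector ϖ p
  no-detector ϖ b 2≤b p∥N detects = fibre-over-minus-square-has-no-point b p∥N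
    (Equivalence.to (detects (- square b) (+ 1) coprime (subst (+ 0 <_) norm≡ N>0) (subst (λ N → p ∥ ℤ.∣ N ∣) norm≡ p∥N))
      (subst (λ N → ϖ ℤ.∣ N ∣ ≡ true) norm≡
        (Equivalence.from (detects (square b) (+ 1) coprime N>0 p∥N) (fibre-over-square-has-point prime b))))
    where
    norm≡ : norm b ≡ normT (- square b) (+ 1)
    norm≡ = sym (normT-neg (square b))
    N>0 = norm-positive 2≤b
    coprime : ∀ {t} → Coprime t 1
    coprime {t} = Coprimality.sym (1-coprimeTo t)

record ExceptionalPrime (S : List ℕ) : Set where
  field
    m     : ℕ
    prime : Prime (3 ℕ.+ m ℕ.* 4)
    ∉S    : (3 ℕ.+ m ℕ.* 4) ∉ S
    b     : ℕ
    2≤b   : 2 ≤ b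
    exact : (3 ℕ.+ m ℕ.* 4) ∥ ℤ.∣ norm b ∣

exceptional-prime : ∀ S → ExceptionalPrime S
exceptional-prime S with norm-odd (sum S !) (ℕP.1≤n! (sum S))
... | n , N≡n , n≡3 with primeFactor4m+3 n n≡3
... | m , p-prime , p∣n = record
  { m = m ; prime = p-prime ; ∉S = p∉S ; b = b ; 2≤b = ℕP.≤-trans 2≤a a≤b ; exact = p∥N }
  where
  open PrimeThreeModFour m p-prime
  open NormModOddPrime p p-prime p∤2
  open Congruence P using (mk)
  K = sum S !
  a = 1 ℕ.+ 2 ℕ.* K
  2≤a : 2 ≤ a
  2≤a = s≤s (ℕP.*-mono-≤ {1} {2} (s≤s z≤n) (ℕP.1≤n! (sum S)))
  p∣N : P ∣ norm a
  p∣N = subst (P ∣_) (sym N≡n) (ℤD.∣ᵤ⇒∣ p∣n)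
  p∉S : p ∉ S
  p∉S p∈S = ≈1⇒∤norm a (mk (subst (P ∣_) (sym (ℤP.pos-* 2 K)) (ℤD.∣n⇒∣m*n (+ 2) (ℤD.∣ᵤ⇒∣ p∣K)))) p∣N
    where
    p∣K : p ℕD.∣ K
    p∣K = ∣factorial (s≤s z≤n) (∈⇒≤sum S p∈S)
  lifted = exact-divisor a p∣N
  b = proj₁ lifted
  a≤b = proj₁ (proj₂ lifted)
  p∥N = ∣×∤⇒∥ (proj₁ (proj₂ (proj₂ lifted))) (proj₂ (proj₂ (proj₂ lifted)))

lemma6p2 : ¬ (Σ (ℕ → Bool) λ ϖ → Σ (List ℕ) λ S →
    ∀ (p : ℕ) → Prime p → p ∉ S →
    ∀ (t0 t1 : ℤ) → Coprime ℤ.∣ t0 ∣ ℤ.∣ t1 ∣ →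
    + 0 < normT t0 t1 → p ∥ ℤ.∣ normT t0 t1 ∣ →
    (ϖ ℤ.∣ normT t0 t1 ∣ ≡ true ⇔ HasQpPoint p (fibreForm t0 t1)))
lemma6p2 (ϖ , S , detects) = no-detector m prime ϖ b 2≤b exact (detects (3 ℕ.+ m ℕ.* 4) prime ∉S)
  where open ExceptionalPrime (exceptional-prime S)
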